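{- Let $G$ be a graph with VC-dimension one. Then $G$ does not contain the path $P_5$ on $5$ vertices as an induced subgraph.
   Context: The VC-dimension of a graph $G$ is the largest $d$ such that some $S\subseteq V(G)$ with $|S|=d$ satisfies: for every $B\subseteq S$ there is a vertex $v$ with $N_G(v)\cap S=B$. -}

module Defs where

open import Level using (0ℓ)
open import Data.Nat using (ℕ; suc; _≤_)
open import Data.Fin using (Fin; toℕ)
open import Data.Fin.Subset using (Subset; _∈_; _⊆_; ∣_∣)
open import Data.Product using (Σ; _×_; ∃)
open import Data.Sum using (_⊎_)
open import Relation.Binary.PropositionalEquality using (_≡_)
open import Relation.Nullary using (¬_)
open import Function.Bundles using (_⇔_)
open import Function.Definitions using (Injective)

record Graph (n : ℕ) : Set₁ where
  field
    Adj   : Fin n → Fin n → Set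
    sym   : ∀ {u v} → Adj u v → Adj v u
    irrefl : ∀ {v} → ¬ Adj v v
open Graph public

Shattered : ∀ {n} → Graph n → Subset n → Set
Shattered {n} G S =
  (B : Subset n) → B ⊆ S →
  Σ (Fin n) λ v → (u : Fin n) → u ∈ S → (Adj G v u ⇔ u ∈ B)

HasVCdim : ∀ {n} → Graph n → ℕ → Set
HasVCdim {n} G d =
  (Σ (Subset n) λ S → (∣ S ∣ ≡ d) × Shattered G S) ×
  ((S : Subset n) → Shattered G S → ∣ S ∣ ≤ d)

P5Adj : Fin 5 → Fin 5 → Set
P5Adj i j = (toℕ i ≡ suc (toℕ j)) ⊎ (toℕ j ≡ suc (toℕ i))

InducedP5 : ∀ {n} → Graph n → Set
InducedP5 {n} G =
  Σ (Fin 5 → Fin n) λ f → Injective _≡_ _≡_ f ×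
    ((i j : Fin 5) → Adj G (f i) (f j) ⇔ P5Adj i j)

-- Vertices 1 and 3 of an induced path 0–1–2–3–4 form a shattered pair: vertex 2
-- is adjacent to both, 0 only to 1, 4 only to 3, and 1 to neither (it is not
-- adjacent to itself nor to 3). A shattered set of size two contradicts
-- VC-dimension one.
module Submission where

open import Defs
open import Data.Bool using (Bool; true; false; T)
open import Data.Empty using (⊥-elim)
open import Data.Fin using (Fin; toℕ; #_)
open import Data.Fin.Subset using (_∈_; _⊂_; _∪_; ⁅_⁆; ∣_∣)
open import Data.Fin.Subset.Properties
  using (_∈?_; x∈p∪q⁻; x∈p∪q⁺; x∈⁅x⁆; x∈⁅y⁆⇒x≡y; x≢y⇒x∉⁅y⁆; ∣⁅x⁆∣≡1; p⊂q⇒∣p∣<∣q∣)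
open import Data.Nat using (ℕ; suc; _<_)
open import Data.Nat.Properties using (<⇒≱; _≟_)
open import Data.Product using (Σ; ∃₂; _×_; _,_)
open import Data.Sum using (_⊎_; inj₁; inj₂)
open import Data.Unit using (tt)
open import Function.Bundles using (_⇔_; mk⇔)
import Function.Properties.Equivalence as ⇔
open import Relation.Binary.Definitions using (Decidable)
open import Relation.Binary.PropositionalEquality using (_≢_; ≢-sym; subst)
open import Relation.Nullary using (¬_; does; proof; contradiction)
open import Relation.Nullary.Decidable using (_⊎-dec_)
open import Relation.Nullary.Reflects using (Reflects; ofʸ; ofⁿ)

Reflects⇒⇔T : ∀ {a} {A : Set a} {b : Bool} → Reflects A b → A ⇔ T b
Reflects⇒⇔T (ofʸ a)  = mk⇔ (λ _ → tt) (λ _ → a)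
Reflects⇒⇔T (ofⁿ ¬a) = mk⇔ ¬a ⊥-elim

1<∣⁅x⁆∪⁅y⁆∣ : ∀ {n} {x y : Fin n} → x ≢ y → 1 < ∣ ⁅ x ⁆ ∪ ⁅ y ⁆ ∣
1<∣⁅x⁆∪⁅y⁆∣ {x = x} {y} x≢y = subst (_< ∣ ⁅ x ⁆ ∪ ⁅ y ⁆ ∣) (∣⁅x⁆∣≡1 x) (p⊂q⇒∣p∣<∣q∣ ⁅x⁆⊂⁅x⁆∪⁅y⁆)
  where
  ⁅x⁆⊂⁅x⁆∪⁅y⁆ : ⁅ x ⁆ ⊂ ⁅ x ⁆ ∪ ⁅ y ⁆
  ⁅x⁆⊂⁅x⁆∪⁅y⁆ = (λ u∈⁅x⁆ → x∈p∪q⁺ (inj₁ u∈⁅x⁆))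
              , y , x∈p∪q⁺ (inj₂ (x∈⁅x⁆ y)) , x≢y⇒x∉⁅y⁆ (≢-sym x≢y)

pair-shattered : ∀ {n} (G : Graph n) (x y : Fin n) →
  ((p q : Bool) → Σ (Fin n) λ v → (Adj G v x ⇔ T p) × (Adj G v y ⇔ T q)) →
  Shattered G (⁅ x ⁆ ∪ ⁅ y ⁆)
pair-shattered G x y realise B _ with realise (does (x ∈? B)) (does (y ∈? B))
... | v , v~x , v~y = v , λ u u∈S → adjacency u (x∈p∪q⁻ ⁅ x ⁆ ⁅ y ⁆ u∈S)
  where
  adjacency : ∀ u → u ∈ ⁅ x ⁆ ⊎ u ∈ ⁅ y ⁆ → Adj G v u ⇔ u ∈ B
  adjacency u (inj₁ u∈⁅x⁆) rewrite x∈⁅y⁆⇒x≡y x u∈⁅x⁆ =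
    ⇔.trans v~x (⇔.sym (Reflects⇒⇔T (proof (x ∈? B))))
  adjacency u (inj₂ u∈⁅y⁆) rewrite x∈⁅y⁆⇒x≡y y u∈⁅y⁆ =
    ⇔.trans v~y (⇔.sym (Reflects⇒⇔T (proof (y ∈? B))))

P5Adj? : Decidable P5Adj
P5Adj? i j = (toℕ i ≟ suc (toℕ j)) ⊎-dec (toℕ j ≟ suc (toℕ i))

inducedP5⇒shattered-pair : ∀ {n} (G : Graph n) → InducedP5 G →
  ∃₂ λ x y → x ≢ y × Shattered G (⁅ x ⁆ ∪ ⁅ y ⁆)
inducedP5⇒shattered-pair {n} G (f , f-injective , f-induced) =
  f (# 1) , f (# 3) , (λ f1≡f3 → contradiction (f-injective f1≡f3) λ ()) ,
  pair-shattered G (f (# 1)) (f (# 3)) realise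
  where
  adjacency : ∀ i j → Adj G (f i) (f j) ⇔ T (does (P5Adj? i j))
  adjacency i j = ⇔.trans (f-induced i j) (Reflects⇒⇔T (proof (P5Adj? i j)))

  pattern-of : ∀ i → Σ (Fin n) λ v →
    (Adj G v (f (# 1)) ⇔ T (does (P5Adj? i (# 1)))) × (Adj G v (f (# 3)) ⇔ T (does (P5Adj? i (# 3))))
  pattern-of i = f i , adjacency i (# 1) , adjacency i (# 3)

  -- P5Adj? evaluates on the closed indices, so each case typechecks by computation.
  realise : (p q : Bool) → Σ (Fin n) λ v → (Adj G v (f (# 1)) ⇔ T p) × (Adj G v (f (# 3)) ⇔ T q)
  realise true  true  = pattern-of (# 2)
  realise true  false = pattern-of (# 0)
  realise false true  = pattern-of (# 4)
  realise false false = pattern-of (# 1)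

lemma2p2 : (n : ℕ) (G : Graph n) → HasVCdim G 1 → ¬ InducedP5 G
lemma2p2 n G (_ , shattered⇒≤1) induced with inducedP5⇒shattered-pair G induced
... | x , y , x≢y , shattered = <⇒≱ (1<∣⁅x⁆∪⁅y⁆∣ x≢y) (shattered⇒≤1 _ shattered)
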